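{- Let $\hat A_1,\hat A_2$ be change actions on the same set $A$ and $\hat B_1,\hat B_2$ change actions on the same set $B$, with $\hat A_2$ coarser than $\hat A_1$ and $\hat B_1$ coarser than $\hat B_2$. If a function $f:A\to B$ is differentiable as a function from $\hat A_1$ to $\hat B_1$, then it is differentiable as a function from $\hat A_2$ to $\hat B_2$.
   Context: A change action $\hat A=(A,\Delta A,\oplus,+,0)$ consists of a set $A$, a monoid $(\Delta A,+,0)$ and a map $\oplus:A\times\Delta A\to A$ with $a\oplus 0=a$ and $a\oplus(\delta_1+\delta_2)=(a\oplus\delta_1)\oplus\delta_2$. A function $f:A\to B$ is differentiable from $\hat A$ to $\hat B$ if there is $\partial f:A\times\Delta A\to\Delta B$ with $f(a\oplus_A\delta)=f(a)\oplus_B\partial f(a,\delta)$ for all $a,\delta$. For change actions $\hat A_1,\hat A_2$ on the same set $A$, $\hat A_1$ is coarser than $\hat A_2$ if for every $a\in A$ and $\delta_1\in\Delta A_1$ there is $\delta_2\in\Delta A_2$ with $a\oplus_{A_1}\delta_1=a\oplus_{A_2}\delta_2$. -}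

module Defs where

open import Level using (Level; _⊔_; suc)
open import Data.Product using (Σ; ∃; _,_)
open import Relation.Binary.PropositionalEquality using (_≡_)
open import Algebra.Structures using (IsMonoid)

record ChangeAction {a : Level} (A : Set a) (d : Level) : Set (a ⊔ suc d) where
  field
    Δ        : Set d
    _+_      : Δ → Δ → Δ
    0Δ       : Δ
    isMonoid : IsMonoid _≡_ _+_ 0Δ
    _⊕_      : A → Δ → A
    ⊕-identity : ∀ (x : A) → x ⊕ 0Δ ≡ x
    ⊕-action   : ∀ (x : A) (δ₁ δ₂ : Δ) → x ⊕ (δ₁ + δ₂) ≡ (x ⊕ δ₁) ⊕ δ₂

open ChangeAction public

Differentiable : ∀ {a b d e} {A : Set a} {B : Set b} →
  ChangeAction A d → ChangeAction B e → (A → B) → Set (a ⊔ b ⊔ d ⊔ e)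
Differentiable {A = A} Â B̂ f =
  Σ (A → Δ Â → Δ B̂) λ ∂f →
    ∀ (x : A) (δ : Δ Â) → f (_⊕_ Â x δ) ≡ _⊕_ B̂ (f x) (∂f x δ)

Coarser : ∀ {a d e} {A : Set a} → ChangeAction A d → ChangeAction A e → Set (a ⊔ d ⊔ e)
Coarser {A = A} Â₁ Â₂ =
  ∀ (x : A) (δ₁ : Δ Â₁) → ∃ λ (δ₂ : Δ Â₂) → _⊕_ Â₁ x δ₁ ≡ _⊕_ Â₂ x δ₂

module Submission where

open import Defs
open import Level using (Level)
open import Data.Product using (_,_; proj₁; proj₂)
open import Relation.Binary.PropositionalEquality using (trans; cong)

differentiable-coarserDomain : ∀ {a b d₁ d₂ e} {A : Set a} {B : Set b}
  (Â₁ : ChangeAction A d₁) (Â₂ : ChangeAction A d₂) (B̂ : ChangeAction B e) →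
  Coarser Â₂ Â₁ → ∀ f → Differentiable Â₁ B̂ f → Differentiable Â₂ B̂ f
differentiable-coarserDomain Â₁ Â₂ B̂ coarse f (∂f , rule) =
  (λ x δ → ∂f x (proj₁ (coarse x δ))) ,
  λ x δ → trans (cong f (proj₂ (coarse x δ))) (rule x (proj₁ (coarse x δ)))

differentiable-finerCodomain : ∀ {a b d e₁ e₂} {A : Set a} {B : Set b}
  (Â : ChangeAction A d) (B̂₁ : ChangeAction B e₁) (B̂₂ : ChangeAction B e₂) →
  Coarser B̂₁ B̂₂ → ∀ f → Differentiable Â B̂₁ f → Differentiable Â B̂₂ f
differentiable-finerCodomain Â B̂₁ B̂₂ coarse f (∂f , rule) =
  (λ x δ → proj₁ (coarse (f x) (∂f x δ))) ,
  λ x δ → trans (rule x δ) (proj₂ (coarse (f x) (∂f x δ)))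

mainTheorem4 : ∀ {a b d₁ d₂ e₁ e₂ : Level} {A : Set a} {B : Set b}
    (Â₁ : ChangeAction A d₁) (Â₂ : ChangeAction A d₂)
    (B̂₁ : ChangeAction B e₁) (B̂₂ : ChangeAction B e₂) →
    Coarser Â₂ Â₁ → Coarser B̂₁ B̂₂ →
    (f : A → B) → Differentiable Â₁ B̂₁ f → Differentiable Â₂ B̂₂ f
mainTheorem4 Â₁ Â₂ B̂₁ B̂₂ coarseA coarseB f f-differentiable =
  differentiable-finerCodomain Â₂ B̂₁ B̂₂ coarseB f
    (differentiable-coarserDomain Â₁ Â₂ B̂₁ coarseA f f-differentiable)
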